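{- Let $\mathcal A=\langle Q,\Sigma,\Delta,\mathcal R\rangle$ be a TA whose language consists of $n$-qubit trees. Let $U$ be one of $\mathrm{CNOT}^c_t$ or $\mathrm{CZ}^c_t$ with $1\le c<t\le n$, or $\mathrm{Toffoli}^{c,c'}_t$ with $1\le c<c'<t\le n$. Define $\mathcal A_1=\langle Q_1,\Sigma_1,\Delta_1,\mathcal R\rangle$ to be $X_t(\mathcal A)$ if $U=\mathrm{CNOT}^c_t$, $Z_t(\mathcal A)$ if $U=\mathrm{CZ}^c_t$, and $\mathrm{CNOT}^{c'}_t(\mathcal A)$ (constructed recursively by this very construction) if $U=\mathrm{Toffoli}^{c,c'}_t$; in all cases $Q\subseteq Q_1$. Let $\mathcal A_1'=\langle Q_1',\Sigma_1,\Delta_1',\mathcal R'\rangle$ be a copy of $\mathcal A_1$ on a set $Q_1'=\{q'\mid q\in Q_1\}$ of fresh states disjoint from $Q$. Let $U(\mathcal A)$ be the TA with states $Q\cup Q_1'$, root states $\mathcal R$, and transitions $\Delta^R\cup\Delta_1'$, where \[\Delta^R=\{q\xrightarrow{x_k}(q_0,q_1)\in\Delta\mid k\ne c\}\cup\{q\xrightarrow{x_c}(q_0,q_1')\mid q\xrightarrow{x_c}(q_0,q_1)\in\Delta\}\cup\{\text{all leaf transitions of }\Delta\}.\] Then $\mathcal L(U(\mathcal A))=\{U(T)\mid T\in\mathcal L(\mathcal A)\}$.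
   Context: Tree automata: a TA is $\mathcal A=\langle Q,\Sigma,\Delta,\mathcal R\rangle$ with finite state set $Q$, ranked alphabet $\Sigma$ of binary and constant symbols, root states $\mathcal R\subseteq Q$, and transitions that are internal $q\xrightarrow{f}(q_0,q_1)$ or leaf $q\xrightarrow{c}()$. It is assumed that no state has leaf transitions with two different constants. A run on a binary tree labels each node with a state so that each leaf labelled $c$ with state $q$ has $q\xrightarrow{c}()\in\Delta$ and each internal node labelled $f$ with state $q$ and children states $q_0$ (left), $q_1$ (right) has $q\xrightarrow{f}(q_0,q_1)\in\Delta$; accepting if the root state is in $\mathcal R$; $\mathcal L(\mathcal A)$ is the set of trees with an accepting run. Encoding: amplitudes are tuples $(a,b,c,d,k)\in\mathbb Z^5$ representing $(1/\sqrt2)^k(a+b\omega+c\omega^2+d\omega^3)$, $\omega=e^{i\pi/4}$; for a scalar $a$, $a\cdot c$ denotes the tuple representing the product (e.g. $-1\cdot(a,b,c,d,k)=(-a,-b,-c,-d,k)$). An $n$-qubit tree is a full binary tree of height $n$ whose internal nodes at depth $j-1$ are labelled $x_j$ and whose leaves are labelled in $\mathbb Z^5$; $T(b)$ for $b\in\{0,1\}^n$ is the leaf reached by going at depth $j-1$ left if $b_j=0$ and right if $b_j=1$; $T$ represents $\sum_bT(b)|b\rangle$. $X_t(\mathcal A)$ is obtained from $\mathcal A$ by replacing each $q\xrightarrow{x_t}(q_0,q_1)$ by $q\xrightarrow{x_t}(q_1,q_0)$. $Z_t(\mathcal A)$ is the TA with states $Q\cup Q'$ ($Q'=\{q'\mid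 q\in Q\}$ disjoint), root states $\mathcal R$, and transitions $q'\xrightarrow{x_k}(q_0',q_1')$ and $q\xrightarrow{x_k}(q_0,q_1)$ for $q\xrightarrow{x_k}(q_0,q_1)\in\Delta$, $k\neq t$; $q'\xrightarrow{x_t}(q_0',q_1')$ and $q\xrightarrow{x_t}(q_0,q_1')$ for $q\xrightarrow{x_t}(q_0,q_1)\in\Delta$; $q\xrightarrow{c}()$ and $q'\xrightarrow{ -1\cdot c}()$ for $q\xrightarrow{c}()\in\Delta$. Gate semantics ($b[t:=v]$ replaces bit $t$ of $b$ by $v$): $X_t(T)(b)=T(b[t:=1-b_t])$, $Z_t(T)(b)=(-1)^{b_t}T(b)$; $\mathrm{CNOT}^c_t(T)(b)=T(b)$ if $b_c=0$ and $X_t(T)(b)$ if $b_c=1$; $\mathrm{CZ}^c_t(T)(b)=T(b)$ if $b_c=0$ and $Z_t(T)(b)$ if $b_c=1$; $\mathrm{Toffoli}^{c,c'}_t(T)(b)=X_t(T)(b)$ if $b_c=b_{c'}=1$ and $T(b)$ otherwise. -}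

module Defs where

open import Data.Nat using (ℕ; zero; suc; _+_; _≤_; _<_)
open import Data.Nat.Properties using (_≟_)
open import Data.Integer using (ℤ; -_; 0ℤ)
open import Data.Fin using (Fin; _↑ˡ_; _↑ʳ_)
open import Data.Bool using (Bool; true; false; if_then_else_; _∧_)
open import Data.List using (List; []; _∷_; map; concatMap)
open import Data.List.Membership.Propositional using (_∈_)
open import Data.Vec using (Vec; []; _∷_)
open import Data.Product using (Σ; _×_; _,_)
open import Relation.Nullary using (does)
open import Function using (id)
open import Relation.Binary.PropositionalEquality using (_≡_)

-- Amplitudes: (a,b,c,d,k) ∈ ℤ⁵ representing (1/√2)^k (a + bω + cω² + dω³)

Amp : Set
Amp = ℤ × ℤ × ℤ × ℤ × ℤ

neg : Amp → Amp
neg (a , b , c , d , k) = (- a , - b , - c , - d , k)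

data Tree : Set where
  leaf : Amp → Tree
  node : ℕ → Tree → Tree → Tree     -- node j l r  is  x_j(l, r)

data QTreeFrom : ℕ → ℕ → Tree → Set where
  leafQ : ∀ {d a} → QTreeFrom d zero (leaf a)
  nodeQ : ∀ {d h l r} → QTreeFrom (suc d) h l → QTreeFrom (suc d) h r →
          QTreeFrom d (suc h) (node d l r)

QTree : ℕ → Tree → Set
QTree n T = QTreeFrom 1 n T

zeroAmp : Amp
zeroAmp = (0ℤ , 0ℤ , 0ℤ , 0ℤ , 0ℤ)

-- T(b): follow b (left on false = 0, right on true = 1) down to a leaf.
-- (The default value only occurs for ill-shaped inputs, never for an
-- n-qubit tree and b of length n.)
_!_ : ∀ {k} → Tree → Vec Bool k → Amp
leaf a       ! _            = a
node _ l r   ! (false ∷ bs) = l ! bs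
node _ l r   ! (true  ∷ bs) = r ! bs
node _ _ _   ! []           = zeroAmp

-- bit b t = b_t  (1-based index)
bit : ∀ {k} → Vec Bool k → ℕ → Bool
bit []       _             = false
bit (x ∷ _)  zero          = false
bit (x ∷ _)  (suc zero)    = x
bit (_ ∷ xs) (suc (suc t)) = bit xs (suc t)

flipAt : ∀ {k} → Vec Bool k → ℕ → Vec Bool k
flipAt []       _             = []
flipAt (x ∷ xs) zero          = x ∷ xs
flipAt (x ∷ xs) (suc zero)    = Data.Bool.not x ∷ xs
flipAt (x ∷ xs) (suc (suc t)) = x ∷ flipAt xs (suc t)

data Gate : Set where
  CNOT    : (c t : ℕ) → Gate
  CZ      : (c t : ℕ) → Gate
  Toffoli : (c c' t : ℕ) → Gate

ValidGate : ℕ → Gate → Set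
ValidGate n (CNOT c t)      = 1 ≤ c × c < t × t ≤ n
ValidGate n (CZ c t)        = 1 ≤ c × c < t × t ≤ n
ValidGate n (Toffoli c c' t) = 1 ≤ c × c < c' × c' < t × t ≤ n

gateSem : ∀ {n} → Gate → (Vec Bool n → Amp) → Vec Bool n → Amp
gateSem (CNOT c t) T b =
  if bit b c then T (flipAt b t) else T b
gateSem (CZ c t) T b =
  if bit b c then (if bit b t then neg (T b) else T b) else T b
gateSem (Toffoli c c' t) T b =
  if bit b c ∧ bit b c' then T (flipAt b t) else T b

data Trans (m : ℕ) : Set where
  int : (q : Fin m) (k : ℕ) (q₀ q₁ : Fin m) → Trans m
  lf  : (q : Fin m) (a : Amp) → Trans m

record TA (m : ℕ) : Set where
  constructor mkTA
  field
    Δ : List (Trans m)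
    R : List (Fin m)
open TA public

LeafDet : ∀ {m} → TA m → Set
LeafDet {m} A = ∀ (q : Fin m) (a a' : Amp) → lf q a ∈ Δ A → lf q a' ∈ Δ A → a ≡ a'

data Run {m} (A : TA m) : Fin m → Tree → Set where
  runLeaf : ∀ {q a} → lf q a ∈ Δ A → Run A q (leaf a)
  runNode : ∀ {q k q₀ q₁ l r} → int q k q₀ q₁ ∈ Δ A →
            Run A q₀ l → Run A q₁ r → Run A q (node k l r)

_∈L_ : ∀ {m} → Tree → TA m → Set
T ∈L A = Σ _ λ q → q ∈ R A × Run A q T

renameT : ∀ {m m'} → (Fin m → Fin m') → Trans m → Trans m'
renameT f (int q k q₀ q₁) = int (f q) k (f q₀) (f q₁)
renameT f (lf q a)        = lf (f q) a

Xt : ∀ {m} → ℕ → TA m → TA m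
Xt {m} t A = mkTA (map sw (Δ A)) (R A)
  where
  sw : Trans m → Trans m
  sw (int q k q₀ q₁) = if does (k ≟ t) then int q k q₁ q₀ else int q k q₀ q₁
  sw (lf q a)        = lf q a

-- Z_t(A): states Q ∪ Q', with q ↦ q ↑ˡ m and q' ↦ m ↑ʳ q
Zt : ∀ {m} → ℕ → TA m → TA (m + m)
Zt {m} t A = mkTA (concatMap tr (Δ A)) (map u (R A))
  where
  u : Fin m → Fin (m + m)
  u q = q ↑ˡ m
  p : Fin m → Fin (m + m)
  p q = m ↑ʳ q
  tr : Trans m → List (Trans (m + m))
  tr (int q k q₀ q₁) =
    if does (k ≟ t)
    then int (p q) k (p q₀) (p q₁) ∷ int (u q) k (u q₀) (p q₁) ∷ []
    else int (p q) k (p q₀) (p q₁) ∷ int (u q) k (u q₀) (u q₁) ∷ []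
  tr (lf q a) = lf (u q) a ∷ lf (p q) (neg a) ∷ []

-- Generic controlled construction: given A (states Q = Fin m), the
-- control index c, A₁ (states Q₁ = Fin m₁) and the inclusion e : Q ⊆ Q₁,
-- build the TA with states Q ∪ Q₁' (q ↦ q ↑ˡ m₁, q₁' ↦ m ↑ʳ q₁),
-- root states R, and transitions Δ^R ∪ Δ₁'.
ctrl : ∀ {m m₁} → ℕ → TA m → TA m₁ → (Fin m → Fin m₁) → TA (m + m₁)
ctrl {m} {m₁} c A A₁ e =
  mkTA (map ΔR (Δ A) Data.List.++ map (renameT (m ↑ʳ_)) (Δ A₁))
       (map u (R A))
  where
  u : Fin m → Fin (m + m₁)
  u q = q ↑ˡ m₁
  ΔR : Trans m → Trans (m + m₁)
  ΔR (int q k q₀ q₁) =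
    if does (k ≟ c) then int (u q) k (u q₀) (m ↑ʳ e q₁)
                    else int (u q) k (u q₀) (u q₁)
  ΔR (lf q a) = lf (u q) a

cnotTA : ∀ {m} → ℕ → ℕ → TA m → TA (m + m)
cnotTA c t A = ctrl c A (Xt t A) id

statesOf : Gate → ℕ → ℕ
statesOf (CNOT _ _)      m = m + m
statesOf (CZ _ _)        m = m + (m + m)
statesOf (Toffoli _ _ _) m = m + (m + m)

gateTA : ∀ {m} → (U : Gate) → TA m → TA (statesOf U m)
gateTA (CNOT c t)       A = cnotTA c t A
gateTA {m} (CZ c t)     A = ctrl c A (Zt t A) (_↑ˡ m)
gateTA {m} (Toffoli c c' t) A = ctrl c A (cnotTA c' t A) (_↑ˡ m)

-- U(A) runs A, except that at an x_c-node it continues in the right subtree with the copy of A₁.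
-- So its runs are the runs of A transported along the tree transformation controlAt c f, where f
-- is the transformation that A₁ realises: swapping the children of x_t-nodes for X_t(A); negating
-- the right subtrees of x_t-nodes for Z_t(A), which is itself the same construction (control x_t)
-- applied to A and its leaf-negated copy; the CNOT transformation for the Toffoli gate. All these
-- transformations are involutions, so L(U(A)) is exactly the image of L(A). On n-qubit trees whose
-- controls lie above the target, the transformed tree represents the gate applied to the original.
module Submission where

open import Defs
open import Data.Nat using (ℕ; zero; suc; _+_; _<_; s≤s; z≤n)
open import Data.Nat.Properties
  using (_≟_; +-suc; +-identityʳ; >⇒≢; m≢1+m+n; n<1+n; m<n⇒m<1+n; m≤n⇒∃[o]m+o≡n)
import Data.Integer.Properties as ℤ
open import Data.Bool using (Bool; true; false; if_then_else_)
open import Data.Bool.Properties using (if-∧)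
open import Data.Fin using (Fin; _↑ˡ_; _↑ʳ_; splitAt)
open import Data.Fin.Properties using (↑ˡ-injective; ↑ʳ-injective; splitAt-↑ˡ; splitAt-↑ʳ)
open import Data.List using (List; []; _∷_; _++_; map; concatMap)
open import Data.List.Properties using (map-∘; map-cong; map-id)
open import Data.List.Membership.Propositional using (_∈_; find)
open import Data.List.Membership.Propositional.Properties
  using (∈-map⁺; ∈-map⁻; ∈-++⁺ˡ; ∈-++⁺ʳ; ∈-++⁻; ∈-concatMap⁺; ∈-concatMap⁻)
open import Data.List.Relation.Unary.Any using (here; there)
import Data.List.Relation.Unary.Any as Any
open import Data.Vec using (Vec; []; _∷_)
open import Data.Product using (Σ; _×_; _,_)
open import Data.Sum using (inj₁; inj₂)
open import Data.Empty using (⊥-elim)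
open import Function using (id; _∘_)
open import Function.Bundles using (_⇔_; mk⇔; Equivalence)
open import Relation.Nullary using (does)
open import Relation.Nullary.Decidable using (dec-true; dec-false)
open import Relation.Binary.PropositionalEquality

swapAt : ℕ → Tree → Tree
swapAt t (leaf a)     = leaf a
swapAt t (node k l r) =
  if does (k ≟ t) then node k (swapAt t r) (swapAt t l) else node k (swapAt t l) (swapAt t r)

negateLeaves : Tree → Tree
negateLeaves (leaf a)     = leaf (neg a)
negateLeaves (node k l r) = node k (negateLeaves l) (negateLeaves r)

controlAt : ℕ → (Tree → Tree) → Tree → Tree
controlAt c f (leaf a)     = leaf a
controlAt c f (node k l r) =
  if does (k ≟ c) then node k (controlAt c f l) (f r) else node k (controlAt c f l) (controlAt c f r)

gateTree : Gate → Tree → Tree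
gateTree (CNOT c t)       = controlAt c (swapAt t)
gateTree (CZ c t)         = controlAt c (controlAt t negateLeaves)
gateTree (Toffoli c c′ t) = controlAt c (controlAt c′ (swapAt t))

neg-involutive : ∀ a → neg (neg a) ≡ a
neg-involutive (a , b , c , d , k) =
  cong₂ _,_ (ℤ.neg-involutive a) (cong₂ _,_ (ℤ.neg-involutive b)
    (cong₂ _,_ (ℤ.neg-involutive c) (cong (_, k) (ℤ.neg-involutive d))))

swapAt-involutive : ∀ t T → swapAt t (swapAt t T) ≡ T
swapAt-involutive t (leaf a)     = refl
swapAt-involutive t (node k l r) with does (k ≟ t) in k≟t
... | true  rewrite k≟t = cong₂ (node k) (swapAt-involutive t l) (swapAt-involutive t r)
... | false rewrite k≟t = cong₂ (node k) (swapAt-involutive t l) (swapAt-involutive t r)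

negateLeaves-involutive : ∀ T → negateLeaves (negateLeaves T) ≡ T
negateLeaves-involutive (leaf a)     = cong leaf (neg-involutive a)
negateLeaves-involutive (node k l r) =
  cong₂ (node k) (negateLeaves-involutive l) (negateLeaves-involutive r)

controlAt-involutive : ∀ {f} c → (∀ T → f (f T) ≡ T) → ∀ T → controlAt c f (controlAt c f T) ≡ T
controlAt-involutive c f-inv (leaf a)     = refl
controlAt-involutive c f-inv (node k l r) with does (k ≟ c) in k≟c
... | true  rewrite k≟c = cong₂ (node k) (controlAt-involutive c f-inv l) (f-inv r)
... | false rewrite k≟c =
  cong₂ (node k) (controlAt-involutive c f-inv l) (controlAt-involutive c f-inv r)

swapAt-QTreeFrom : ∀ {d h T} t → QTreeFrom d h T → QTreeFrom d h (swapAt t T)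
swapAt-QTreeFrom t leafQ = leafQ
swapAt-QTreeFrom {d} t (nodeQ ql qr) with does (d ≟ t)
... | true  = nodeQ (swapAt-QTreeFrom t qr) (swapAt-QTreeFrom t ql)
... | false = nodeQ (swapAt-QTreeFrom t ql) (swapAt-QTreeFrom t qr)

negateLeaves-QTreeFrom : ∀ {d h T} → QTreeFrom d h T → QTreeFrom d h (negateLeaves T)
negateLeaves-QTreeFrom leafQ         = leafQ
negateLeaves-QTreeFrom (nodeQ ql qr) = nodeQ (negateLeaves-QTreeFrom ql) (negateLeaves-QTreeFrom qr)

controlAt-QTreeFrom : ∀ {f d h T} c → (∀ {d h T} → QTreeFrom d h T → QTreeFrom d h (f T)) →
                      QTreeFrom d h T → QTreeFrom d h (controlAt c f T)
controlAt-QTreeFrom c f-shape leafQ = leafQ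
controlAt-QTreeFrom {d = d} c f-shape (nodeQ ql qr) with does (d ≟ c)
... | true  = nodeQ (controlAt-QTreeFrom c f-shape ql) (f-shape qr)
... | false = nodeQ (controlAt-QTreeFrom c f-shape ql) (controlAt-QTreeFrom c f-shape qr)

gateTree-QTreeFrom : ∀ U {d h T} → QTreeFrom d h T → QTreeFrom d h (gateTree U T)
gateTree-QTreeFrom (CNOT c t)       = controlAt-QTreeFrom c (swapAt-QTreeFrom t)
gateTree-QTreeFrom (CZ c t)         =
  controlAt-QTreeFrom c (controlAt-QTreeFrom t negateLeaves-QTreeFrom)
gateTree-QTreeFrom (Toffoli c c′ t) =
  controlAt-QTreeFrom c (controlAt-QTreeFrom c′ (swapAt-QTreeFrom t))

!-injective : ∀ {d h S S′} → QTreeFrom d h S → QTreeFrom d h S′ →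
              (∀ (b : Vec Bool h) → S ! b ≡ S′ ! b) → S ≡ S′
!-injective leafQ         leafQ           S≗S′ = cong leaf (S≗S′ [])
!-injective (nodeQ ql qr) (nodeQ ql′ qr′) S≗S′ =
  cong₂ (node _) (!-injective ql ql′ (S≗S′ ∘ (false ∷_))) (!-injective qr qr′ (S≗S′ ∘ (true ∷_)))

label-here : ∀ {d c} → d + 0 ≡ c → d ≡ c
label-here {d} = trans (sym (+-identityʳ d))

label-above : ∀ {d c} i → d + suc i ≡ c → does (d ≟ c) ≡ false
label-above {d} {c} i eq =
  dec-false (d ≟ c) λ d≡c → m≢1+m+n d (trans d≡c (trans (sym eq) (+-suc d i)))

label-child : ∀ {d c} i → d + suc i ≡ c → suc d + i ≡ c
label-child {d} i eq = trans (sym (+-suc d i)) eq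

swapAt-below : ∀ {t d h T} → t < d → QTreeFrom d h T → swapAt t T ≡ T
swapAt-below t<d leafQ = refl
swapAt-below {t} {d} t<d (nodeQ ql qr) rewrite dec-false (d ≟ t) (>⇒≢ t<d) =
  cong₂ (node d) (swapAt-below (m<n⇒m<1+n t<d) ql) (swapAt-below (m<n⇒m<1+n t<d) qr)

controlAt-below : ∀ {c f d h T} → c < d → QTreeFrom d h T → controlAt c f T ≡ T
controlAt-below c<d leafQ = refl
controlAt-below {c} {d = d} c<d (nodeQ ql qr) rewrite dec-false (d ≟ c) (>⇒≢ c<d) =
  cong₂ (node d) (controlAt-below (m<n⇒m<1+n c<d) ql) (controlAt-below (m<n⇒m<1+n c<d) qr)

swapAt-! : ∀ {d h T t} k → QTreeFrom d h T → d + k ≡ t → ∀ (b : Vec Bool h) →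
           swapAt t T ! b ≡ T ! flipAt b (suc k)
swapAt-! k leafQ _ [] = refl
swapAt-! zero (nodeQ ql qr) eq (x ∷ bs) with label-here eq
swapAt-! {d} zero (nodeQ ql qr) eq (false ∷ bs) | refl rewrite dec-true (d ≟ d) refl =
  cong (_! bs) (swapAt-below (n<1+n d) qr)
swapAt-! {d} zero (nodeQ ql qr) eq (true ∷ bs)  | refl rewrite dec-true (d ≟ d) refl =
  cong (_! bs) (swapAt-below (n<1+n d) ql)
swapAt-! (suc k) (nodeQ ql qr) eq (false ∷ bs) rewrite label-above k eq =
  swapAt-! k ql (label-child k eq) bs
swapAt-! (suc k) (nodeQ ql qr) eq (true ∷ bs)  rewrite label-above k eq =
  swapAt-! k qr (label-child k eq) bs

negateLeaves-! : ∀ T {h} (b : Vec Bool h) → negateLeaves T ! b ≡ neg (T ! b)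
negateLeaves-! (leaf a)     b            = refl
negateLeaves-! (node k l r) []           = refl
negateLeaves-! (node k l r) (false ∷ bs) = negateLeaves-! l bs
negateLeaves-! (node k l r) (true ∷ bs)  = negateLeaves-! r bs

Operator : Set
Operator = ∀ {h} → (Vec Bool h → Amp) → Vec Bool h → Amp

-- P s is the operator that f realises, seen from s levels above the subtrees it is applied to;
-- descending one level consumes one bit.
controlAt-! : ∀ {c f} (P : ℕ → Operator) →
  (∀ s {h} φ x (bs : Vec Bool h) → P (suc s) φ (x ∷ bs) ≡ P s (λ b → φ (x ∷ b)) bs) →
  (∀ {h T} → QTreeFrom (suc c) h T → ∀ (b : Vec Bool h) → f T ! b ≡ P 0 (T !_) b) →
  ∀ {d h T} i → QTreeFrom d h T → d + i ≡ c → ∀ (b : Vec Bool h) →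
  controlAt c f T ! b ≡ (if bit b (suc i) then P (suc i) (T !_) b else T ! b)
controlAt-! P shift f-! i leafQ _ [] = refl
controlAt-! P shift f-! zero (nodeQ ql qr) eq (x ∷ bs) with label-here eq
controlAt-! P shift f-! {d} zero (nodeQ ql qr) eq (false ∷ bs) | refl
  rewrite dec-true (d ≟ d) refl = cong (_! bs) (controlAt-below (n<1+n d) ql)
controlAt-! P shift f-! {d} zero (nodeQ ql qr) eq (true ∷ bs)  | refl
  rewrite dec-true (d ≟ d) refl = trans (f-! qr bs) (sym (shift 0 _ true bs))
controlAt-! P shift f-! (suc i) (nodeQ ql qr) eq (false ∷ bs) rewrite label-above i eq =
  trans (controlAt-! P shift f-! i ql (label-child i eq) bs)
        (cong (if bit bs (suc i) then_else _) (sym (shift (suc i) _ false bs)))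
controlAt-! P shift f-! (suc i) (nodeQ ql qr) eq (true ∷ bs)  rewrite label-above i eq =
  trans (controlAt-! P shift f-! i qr (label-child i eq) bs)
        (cong (if bit bs (suc i) then_else _) (sym (shift (suc i) _ true bs)))

controlAt-swapAt-! : ∀ {d h T c} i {k} → QTreeFrom d h T → d + i ≡ c → ∀ (b : Vec Bool h) →
  controlAt c (swapAt (suc c + k)) T ! b ≡
  (if bit b (suc i) then T ! flipAt b (suc (suc i + k)) else T ! b)
controlAt-swapAt-! i {k} =
  controlAt-! (λ s φ b → φ (flipAt b (suc (s + k)))) (λ _ _ _ _ → refl) (λ QT → swapAt-! k QT refl) i

controlAt-negateLeaves-! : ∀ {d h T c} i → QTreeFrom d h T → d + i ≡ c → ∀ (b : Vec Bool h) →
  controlAt c negateLeaves T ! b ≡ (if bit b (suc i) then neg (T ! b) else T ! b)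
controlAt-negateLeaves-! =
  controlAt-! (λ _ φ b → neg (φ b)) (λ _ _ _ _ → refl) (λ {_} {T} _ → negateLeaves-! T)

gateTree-! : ∀ {n T} U → ValidGate n U → QTree n T → ∀ (b : Vec Bool n) →
  gateTree U T ! b ≡ gateSem U (T !_) b
gateTree-! (CNOT (suc i) t) (s≤s z≤n , c<t , _) QT b with m≤n⇒∃[o]m+o≡n c<t
... | k , refl = controlAt-swapAt-! i QT refl b
gateTree-! (CZ (suc i) t) (s≤s z≤n , c<t , _) QT b with m≤n⇒∃[o]m+o≡n c<t
... | k , refl =
  controlAt-! (λ s φ b → if bit b (suc (s + k)) then neg (φ b) else φ b) (λ _ _ _ _ → refl)
              (λ QT′ → controlAt-negateLeaves-! k QT′ refl) i QT refl b
gateTree-! (Toffoli (suc i) c′ t) (s≤s z≤n , c<c′ , c′<t , _) QT b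
  with m≤n⇒∃[o]m+o≡n c<c′ | m≤n⇒∃[o]m+o≡n c′<t
... | k₁ , refl | k₂ , refl = trans
  (controlAt-! (λ s φ b → if bit b (suc (s + k₁)) then φ (flipAt b (suc (suc (s + k₁) + k₂))) else φ b)
               (λ _ _ _ _ → refl) (λ QT′ → controlAt-swapAt-! k₁ QT′ refl) i QT refl b)
  (sym (if-∧ (bit b (suc i))))

record RunCorrespondence {m m′} (A : TA m) (B : TA m′) (e : Fin m → Fin m′) (f : Tree → Tree) : Set where
  field
    forward  : ∀ {q T} → Run A q T → Run B (e q) (f T)
    backward : ∀ {q S} → Run B (e q) S → Run A q (f S)
open RunCorrespondence

Run-mono : ∀ {m} {A B : TA m} → (∀ {tr} → tr ∈ Δ A → tr ∈ Δ B) → ∀ {q T} → Run A q T → Run B q T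
Run-mono A⊆B (runLeaf mem)       = runLeaf (A⊆B mem)
Run-mono A⊆B (runNode mem rl rr) = runNode (A⊆B mem) (Run-mono A⊆B rl) (Run-mono A⊆B rr)

involution-correspondence : ∀ {m f} (Φ : TA m → TA m) → (∀ A → Φ (Φ A) ≡ A) →
  (∀ {A q T} → Run A q T → Run (Φ A) q (f T)) → ∀ A → RunCorrespondence A (Φ A) id f
involution-correspondence Φ Φ-involutive fwd A = record
  { forward  = fwd
  ; backward = λ {q} run → subst (λ B → Run B q _) (Φ-involutive A) (fwd run)
  }

module _ {m : ℕ} (t : ℕ) where

  Xt-involutive : (A : TA m) → Xt t (Xt t A) ≡ A
  Xt-involutive (mkTA Δs R) = cong (λ Δs′ → mkTA Δs′ R) (swap-twice Δs)
    where
    swap-twice : ∀ Δs → Δ (Xt t (Xt t (mkTA Δs R))) ≡ Δs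
    swap-twice []                   = refl
    swap-twice (lf q a ∷ Δs)        = cong (lf q a ∷_) (swap-twice Δs)
    swap-twice (int q k q₀ q₁ ∷ Δs) with does (k ≟ t) in k≟t
    ... | true  rewrite k≟t = cong (int q k q₀ q₁ ∷_) (swap-twice Δs)
    ... | false rewrite k≟t = cong (int q k q₀ q₁ ∷_) (swap-twice Δs)

  Xt-int : ∀ {A : TA m} {q k q₀ q₁} → int q k q₀ q₁ ∈ Δ A →
           (if does (k ≟ t) then int q k q₁ q₀ else int q k q₀ q₁) ∈ Δ (Xt t A)
  Xt-int = ∈-map⁺ _

  Xt-forward : ∀ {A : TA m} {q T} → Run A q T → Run (Xt t A) q (swapAt t T)
  Xt-forward (runLeaf mem) = runLeaf (∈-map⁺ _ mem)
  Xt-forward {A} (runNode {k = k} mem rl rr) with does (k ≟ t) | Xt-int {A} mem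
  ... | true  | mem′ = runNode mem′ (Xt-forward rr) (Xt-forward rl)
  ... | false | mem′ = runNode mem′ (Xt-forward rl) (Xt-forward rr)

  Xt-correspondence : (A : TA m) → RunCorrespondence A (Xt t A) id (swapAt t)
  Xt-correspondence = involution-correspondence (Xt t) Xt-involutive Xt-forward

negateTrans : ∀ {m} → Trans m → Trans m
negateTrans (int q k q₀ q₁) = int q k q₀ q₁
negateTrans (lf q a)        = lf q (neg a)

negateTA : ∀ {m} → TA m → TA m
negateTA A = mkTA (map negateTrans (Δ A)) (R A)

negateTA-involutive : ∀ {m} (A : TA m) → negateTA (negateTA A) ≡ A
negateTA-involutive A = cong (λ Δs → mkTA Δs (R A)) (begin
  map negateTrans (map negateTrans (Δ A)) ≡⟨ map-∘ (Δ A) ⟨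
  map (negateTrans ∘ negateTrans) (Δ A)   ≡⟨ map-cong negateTrans-involutive (Δ A) ⟩
  map id (Δ A)                            ≡⟨ map-id (Δ A) ⟩
  Δ A                                     ∎)
  where
  open ≡-Reasoning
  negateTrans-involutive : ∀ tr → negateTrans (negateTrans tr) ≡ tr
  negateTrans-involutive (int q k q₀ q₁) = refl
  negateTrans-involutive (lf q a)        = cong (lf q) (neg-involutive a)

negateTA-forward : ∀ {m} {A : TA m} {q T} → Run A q T → Run (negateTA A) q (negateLeaves T)
negateTA-forward (runLeaf mem)       = runLeaf (∈-map⁺ negateTrans mem)
negateTA-forward (runNode mem rl rr) =
  runNode (∈-map⁺ negateTrans mem) (negateTA-forward rl) (negateTA-forward rr)

negateTA-correspondence : ∀ {m} (A : TA m) → RunCorrespondence A (negateTA A) id negateLeaves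
negateTA-correspondence = involution-correspondence negateTA negateTA-involutive negateTA-forward

↑ˡ≢↑ʳ : ∀ {m n} (i : Fin m) (j : Fin n) → i ↑ˡ n ≢ m ↑ʳ j
↑ˡ≢↑ʳ {m} {n} i j eq
  with trans (sym (splitAt-↑ˡ m i n)) (trans (cong (splitAt m) eq) (splitAt-↑ʳ m n j))
... | ()

module Control {m m₁ : ℕ} (c : ℕ) (A : TA m) (A₁ : TA m₁) (e : Fin m → Fin m₁) where

  C : TA (m + m₁)
  C = ctrl c A A₁ e

  data ControlTrans : Trans (m + m₁) → Set where
    leafᴬ    : ∀ {q a} → lf q a ∈ Δ A → ControlTrans (lf (q ↑ˡ m₁) a)
    controlᴬ : ∀ {q k q₀ q₁} → int q k q₀ q₁ ∈ Δ A → does (k ≟ c) ≡ true →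
               ControlTrans (int (q ↑ˡ m₁) k (q₀ ↑ˡ m₁) (m ↑ʳ e q₁))
    plainᴬ   : ∀ {q k q₀ q₁} → int q k q₀ q₁ ∈ Δ A → does (k ≟ c) ≡ false →
               ControlTrans (int (q ↑ˡ m₁) k (q₀ ↑ˡ m₁) (q₁ ↑ˡ m₁))
    leafᴬ¹   : ∀ {x a} → lf x a ∈ Δ A₁ → ControlTrans (lf (m ↑ʳ x) a)
    nodeᴬ¹   : ∀ {x k x₀ x₁} → int x k x₀ x₁ ∈ Δ A₁ →
               ControlTrans (int (m ↑ʳ x) k (m ↑ʳ x₀) (m ↑ʳ x₁))

  ctrl-view : ∀ {tr} → tr ∈ Δ C → ControlTrans tr
  ctrl-view mem with ∈-++⁻ (map _ (Δ A)) mem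
  ... | inj₂ mem₁ with ∈-map⁻ (renameT (m ↑ʳ_)) mem₁
  ...   | lf x a , tr∈ , refl        = leafᴬ¹ tr∈
  ...   | int x k x₀ x₁ , tr∈ , refl = nodeᴬ¹ tr∈
  ctrl-view mem | inj₁ mem₀ with ∈-map⁻ _ mem₀
  ...   | lf q a , tr∈ , refl        = leafᴬ tr∈
  ...   | int q k q₀ q₁ , tr∈ , refl with does (k ≟ c) in k≟c
  ...     | true  = controlᴬ tr∈ k≟c
  ...     | false = plainᴬ tr∈ k≟c

  ctrl-int : ∀ {q k q₀ q₁} → int q k q₀ q₁ ∈ Δ A →
    (if does (k ≟ c) then int (q ↑ˡ m₁) k (q₀ ↑ˡ m₁) (m ↑ʳ e q₁)
                     else int (q ↑ˡ m₁) k (q₀ ↑ˡ m₁) (q₁ ↑ˡ m₁)) ∈ Δ C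
  ctrl-int mem = ∈-++⁺ˡ (∈-map⁺ _ mem)

  ctrl-lift : ∀ {x S} → Run A₁ x S → Run C (m ↑ʳ x) S
  ctrl-lift (runLeaf mem)       = runLeaf (∈-++⁺ʳ _ (∈-map⁺ _ mem))
  ctrl-lift (runNode mem rl rr) = runNode (∈-++⁺ʳ _ (∈-map⁺ _ mem)) (ctrl-lift rl) (ctrl-lift rr)

  ctrl-forward : ∀ {f} → (∀ {q T} → Run A q T → Run A₁ (e q) (f T)) →
                 ∀ {q T} → Run A q T → Run C (q ↑ˡ m₁) (controlAt c f T)
  ctrl-forward fwd (runLeaf mem) = runLeaf (∈-++⁺ˡ (∈-map⁺ _ mem))
  ctrl-forward fwd (runNode {k = k} mem rl rr) with does (k ≟ c) | ctrl-int mem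
  ... | true  | mem′ = runNode mem′ (ctrl-forward fwd rl) (ctrl-lift (fwd rr))
  ... | false | mem′ = runNode mem′ (ctrl-forward fwd rl) (ctrl-forward fwd rr)

  -- The root state is kept general (y with y ≡ …), as _↑ˡ_ and _↑ʳ_ block unification.

  ctrl-unlift : ∀ {y x S} → Run C y S → y ≡ m ↑ʳ x → Run A₁ x S
  ctrl-unlift (runLeaf mem) y≡ with ctrl-view mem
  ... | leafᴬ _ = ⊥-elim (↑ˡ≢↑ʳ _ _ y≡)
  ... | leafᴬ¹ mem₁ with ↑ʳ-injective m _ _ y≡
  ...   | refl = runLeaf mem₁
  ctrl-unlift (runNode mem rl rr) y≡ with ctrl-view mem
  ... | controlᴬ _ _ = ⊥-elim (↑ˡ≢↑ʳ _ _ y≡)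
  ... | plainᴬ _ _   = ⊥-elim (↑ˡ≢↑ʳ _ _ y≡)
  ... | nodeᴬ¹ mem₁ with ↑ʳ-injective m _ _ y≡
  ...   | refl = runNode mem₁ (ctrl-unlift rl refl) (ctrl-unlift rr refl)

  ctrl-backward : ∀ {f} → (∀ {q S} → Run A₁ (e q) S → Run A q (f S)) →
                  ∀ {y q S} → Run C y S → y ≡ q ↑ˡ m₁ → Run A q (controlAt c f S)
  ctrl-backward bwd (runLeaf mem) y≡ with ctrl-view mem
  ... | leafᴬ¹ _ = ⊥-elim (↑ˡ≢↑ʳ _ _ (sym y≡))
  ... | leafᴬ mem₀ with ↑ˡ-injective m₁ _ _ y≡
  ...   | refl = runLeaf mem₀
  ctrl-backward bwd (runNode mem rl rr) y≡ with ctrl-view mem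
  ... | nodeᴬ¹ _ = ⊥-elim (↑ˡ≢↑ʳ _ _ (sym y≡))
  ... | controlᴬ mem₀ k≟c with ↑ˡ-injective m₁ _ _ y≡
  ...   | refl rewrite k≟c =
    runNode mem₀ (ctrl-backward bwd rl refl) (bwd (ctrl-unlift rr refl))
  ctrl-backward bwd (runNode mem rl rr) y≡ | plainᴬ mem₀ k≟c with ↑ˡ-injective m₁ _ _ y≡
  ...   | refl rewrite k≟c =
    runNode mem₀ (ctrl-backward bwd rl refl) (ctrl-backward bwd rr refl)

  ctrl-correspondence : ∀ {f} → RunCorrespondence A A₁ e f →
                        RunCorrespondence A C (_↑ˡ m₁) (controlAt c f)
  ctrl-correspondence corr = record
    { forward  = ctrl-forward (forward corr)
    ; backward = λ run → ctrl-backward (backward corr) run refl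
    }

  ctrl-language : ∀ {f} → RunCorrespondence A A₁ e f → (∀ T → f (f T) ≡ T) → ∀ S →
                  S ∈L C ⇔ (Σ Tree λ T → T ∈L A × S ≡ controlAt c f T)
  ctrl-language {f} corr f-inv S = mk⇔ to from
    where
    to : S ∈L C → Σ Tree λ T → T ∈L A × S ≡ controlAt c f T
    to (y , y∈R , run) with ∈-map⁻ _ y∈R
    ... | q , q∈R , refl =
      controlAt c f S , (q , q∈R , backward (ctrl-correspondence corr) run) ,
      sym (controlAt-involutive c f-inv S)
    from : (Σ Tree λ T → T ∈L A × S ≡ controlAt c f T) → S ∈L C
    from (T , (q , q∈R , run) , refl) =
      q ↑ˡ m₁ , ∈-map⁺ _ q∈R , forward (ctrl-correspondence corr) run

module _ {m : ℕ} (t : ℕ) where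

  -- A named copy of the local function of Zt: the transitions contributed by one transition of A.
  zTrans : Trans m → List (Trans (m + m))
  zTrans (int q k q₀ q₁) =
    if does (k ≟ t)
    then int (m ↑ʳ q) k (m ↑ʳ q₀) (m ↑ʳ q₁) ∷ int (q ↑ˡ m) k (q₀ ↑ˡ m) (m ↑ʳ q₁) ∷ []
    else int (m ↑ʳ q) k (m ↑ʳ q₀) (m ↑ʳ q₁) ∷ int (q ↑ˡ m) k (q₀ ↑ˡ m) (q₁ ↑ˡ m) ∷ []
  zTrans (lf q a) = lf (q ↑ˡ m) a ∷ lf (m ↑ʳ q) (neg a) ∷ []

  Zt-Δ : (A : TA m) → Δ (Zt t A) ≡ concatMap zTrans (Δ A)
  Zt-Δ (mkTA Δs R) = go Δs
    where
    go : ∀ Δs → Δ (Zt t (mkTA Δs R)) ≡ concatMap zTrans Δs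
    go []                   = refl
    go (lf q a ∷ Δs)        = cong (zTrans (lf q a) ++_) (go Δs)
    go (int q k q₀ q₁ ∷ Δs) = cong (zTrans (int q k q₀ q₁) ++_) (go Δs)

  zTrans-copy : ∀ {q k q₀ q₁} → int (m ↑ʳ q) k (m ↑ʳ q₀) (m ↑ʳ q₁) ∈ zTrans (int q k q₀ q₁)
  zTrans-copy {k = k} with does (k ≟ t)
  ... | true  = here refl
  ... | false = here refl

  zTrans-control : ∀ {q k q₀ q₁} → does (k ≟ t) ≡ true →
                   int (q ↑ˡ m) k (q₀ ↑ˡ m) (m ↑ʳ q₁) ∈ zTrans (int q k q₀ q₁)
  zTrans-control k≟t rewrite k≟t = there (here refl)

  zTrans-plain : ∀ {q k q₀ q₁} → does (k ≟ t) ≡ false →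
                 int (q ↑ˡ m) k (q₀ ↑ˡ m) (q₁ ↑ˡ m) ∈ zTrans (int q k q₀ q₁)
  zTrans-plain k≟t rewrite k≟t = there (here refl)

  -- Z_t(A) has the same transitions as the controlled construction with control x_t applied to
  -- A and its leaf-negated copy; only their order in the list differs.
  module _ (A : TA m) where
    open Control t A (negateTA A) id

    Zt∈ : ∀ {x tr} → x ∈ Δ A → tr ∈ zTrans x → tr ∈ Δ (Zt t A)
    Zt∈ x∈ tr∈ = subst (_ ∈_) (sym (Zt-Δ A)) (∈-concatMap⁺ zTrans (Any.map (λ { refl → tr∈ }) x∈))

    Zt⊆ctrl : ∀ {tr} → tr ∈ Δ (Zt t A) → tr ∈ Δ C
    Zt⊆ctrl mem with find (∈-concatMap⁻ zTrans (subst (_ ∈_) (Zt-Δ A) mem))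
    ... | lf q a , x∈ , here refl         = ∈-++⁺ˡ (∈-map⁺ _ x∈)
    ... | lf q a , x∈ , there (here refl) = ∈-++⁺ʳ _ (∈-map⁺ _ (∈-map⁺ negateTrans x∈))
    ... | int q k q₀ q₁ , x∈ , tr∈ with does (k ≟ t) | ctrl-int x∈ | tr∈
    ...   | true  | mem | here refl         = ∈-++⁺ʳ _ (∈-map⁺ _ (∈-map⁺ negateTrans x∈))
    ...   | true  | mem | there (here refl) = mem
    ...   | false | mem | here refl         = ∈-++⁺ʳ _ (∈-map⁺ _ (∈-map⁺ negateTrans x∈))
    ...   | false | mem | there (here refl) = mem

    ctrl⊆Zt : ∀ {tr} → tr ∈ Δ C → tr ∈ Δ (Zt t A)
    ctrl⊆Zt mem with ctrl-view mem
    ... | leafᴬ x∈        = Zt∈ x∈ (here refl)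
    ... | controlᴬ x∈ k≟t = Zt∈ x∈ (zTrans-control k≟t)
    ... | plainᴬ x∈ k≟t   = Zt∈ x∈ (zTrans-plain k≟t)
    ... | leafᴬ¹ mem₁ with ∈-map⁻ negateTrans mem₁
    ...   | lf q a , x∈ , refl = Zt∈ x∈ (there (here refl))
    ctrl⊆Zt mem | nodeᴬ¹ mem₁ with ∈-map⁻ negateTrans mem₁
    ...   | int q k q₀ q₁ , x∈ , refl = Zt∈ x∈ zTrans-copy

    Zt-correspondence : RunCorrespondence A (Zt t A) (_↑ˡ m) (controlAt t negateLeaves)
    Zt-correspondence = record
      { forward  = λ run → Run-mono ctrl⊆Zt (forward controlledNegation run)
      ; backward = λ run → backward controlledNegation (Run-mono Zt⊆ctrl run)
      }
      where
      controlledNegation : RunCorrespondence A C (_↑ˡ m) (controlAt t negateLeaves)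
      controlledNegation = ctrl-correspondence (negateTA-correspondence A)

gateTA-language : ∀ {m} (A : TA m) U S →
                  S ∈L gateTA U A ⇔ (Σ Tree λ T → T ∈L A × S ≡ gateTree U T)
gateTA-language A (CNOT c t) =
  Control.ctrl-language c A (Xt t A) id (Xt-correspondence t A) (swapAt-involutive t)
gateTA-language {m} A (CZ c t) =
  Control.ctrl-language c A (Zt t A) (_↑ˡ m) (Zt-correspondence t A)
    (controlAt-involutive t negateLeaves-involutive)
gateTA-language {m} A (Toffoli c c′ t) =
  Control.ctrl-language c A (cnotTA c′ t A) (_↑ˡ m)
    (Control.ctrl-correspondence c′ A (Xt t A) id (Xt-correspondence t A))
    (controlAt-involutive c′ (swapAt-involutive t))

theorem5p3 : (n m : ℕ) (A : TA m) → LeafDet A →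
    (∀ T → T ∈L A → QTree n T) →
    (U : Gate) → ValidGate n U →
    (S : Tree) →
    (S ∈L gateTA U A) ⇔
      (Σ Tree λ T → T ∈L A × QTree n S ×
        ((b : Vec Bool n) → S ! b ≡ gateSem U (λ b' → T ! b') b))
theorem5p3 n m A _ accepted U valid S = mk⇔ to from
  where
  open Equivalence (gateTA-language A U S) renaming (to to image-of; from to image)

  gate-! : ∀ T → T ∈L A → QTree n (gateTree U T) ×
           ((b : Vec Bool n) → gateTree U T ! b ≡ gateSem U (T !_) b)
  gate-! T T∈ = gateTree-QTreeFrom U (accepted T T∈) , gateTree-! U valid (accepted T T∈)

  to : S ∈L gateTA U A →
       Σ Tree λ T → T ∈L A × QTree n S × ((b : Vec Bool n) → S ! b ≡ gateSem U (T !_) b)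
  to S∈ with image-of S∈
  ... | T , T∈ , refl = T , T∈ , gate-! T T∈

  from : (Σ Tree λ T → T ∈L A × QTree n S × ((b : Vec Bool n) → S ! b ≡ gateSem U (T !_) b)) →
         S ∈L gateTA U A
  from (T , T∈ , QS , S-!) with gate-! T T∈
  ... | QU , U-! = image (T , T∈ , !-injective QS QU (λ b → trans (S-! b) (sym (U-! b))))
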